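{- For every finite simple graph $H$ there exists a finite simple graph $G$ in which all maximal open packings have the same cardinality and such that $H$ is an induced subgraph of $G$.
   Context: A set $P$ of vertices of a graph is an open packing if no two distinct vertices of $P$ have a common neighbor; a maximal open packing is one maximal under inclusion. -}

module Defs where

open import Data.Nat using (ℕ)
open import Data.Bool using (Bool; true; false)
open import Data.Fin using (Fin)
open import Data.Fin.Subset using (Subset; _∈_; _⊆_; ∣_∣)
open import Data.Product using (_×_; Σ; ∃)
open import Relation.Nullary using (¬_)
open import Relation.Binary.PropositionalEquality using (_≡_)
open import Function.Definitions using (Injective)

record Graph (n : ℕ) : Set where
  field
    adj   : Fin n → Fin n → Bool
    sym   : ∀ u v → adj u v ≡ adj v u
    irrefl : ∀ v → adj v v ≡ false

open Graph public

Adj : ∀ {n} → Graph n → Fin n → Fin n → Set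
Adj G u v = adj G u v ≡ true

IsOpenPacking : ∀ {n} → Graph n → Subset n → Set
IsOpenPacking {n} G P =
  ∀ u v → u ∈ P → v ∈ P → ¬ (u ≡ v) → ∀ (w : Fin n) → ¬ (Adj G u w × Adj G v w)

IsMaximalOpenPacking : ∀ {n} → Graph n → Subset n → Set
IsMaximalOpenPacking G P =
  IsOpenPacking G P × (∀ Q → IsOpenPacking G Q → P ⊆ Q → Q ≡ P)

AllMaximalOpenPackingsEqualSize : ∀ {n} → Graph n → Set
AllMaximalOpenPackingsEqualSize G =
  ∀ P Q → IsMaximalOpenPacking G P → IsMaximalOpenPacking G Q → ∣ P ∣ ≡ ∣ Q ∣

IsInducedSubgraph : ∀ {m n} → Graph m → Graph n → Set
IsInducedSubgraph {m} {n} H G =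
  Σ (Fin m → Fin n) λ f → Injective _≡_ _≡_ f × (∀ u v → adj H u v ≡ adj G (f u) (f v))

module Submission where

-- Call a graph *2-linked* when any two distinct vertices have a
-- common neighbour.  In a 2-linked graph an open packing contains at most one
-- vertex, and (once the graph has a vertex) a maximal open packing contains at
-- least one, since any singleton is an open packing.  Hence every maximal open
-- packing of a nonempty 2-linked graph is a singleton, and all of them have the
-- same cardinality 1.
--
-- It therefore suffices to embed H as an induced subgraph of a 2-linked graph.
-- We take the join H ∨ K₃ of H with a triangle: H is induced in any join
-- H ∨ K, and H ∨ K is 2-linked as soon as K is nonempty, 2-linked and has no
-- isolated vertex, which the triangle satisfies.

open import Defs hiding (sym)
open import Data.Nat using (ℕ; _+_)
open import Data.Product using (Σ; ∃; _×_; _,_)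
open import Data.Sum using (_⊎_; inj₁; inj₂)
open import Data.Bool using (Bool; true; false)
open import Data.Fin using (Fin; zero; suc; _≟_; splitAt; join; _↑ˡ_; _↑ʳ_)
open import Data.Fin.Properties using (splitAt-join; join-splitAt; splitAt-↑ˡ; ↑ˡ-injective)
open import Data.Fin.Subset using (Nonempty; _∈_; _⊆_; ∣_∣; ⁅_⁆)
open import Data.Fin.Subset.Properties using (nonempty?; x∈⁅x⁆; x∈⁅y⁆⇒x≡y; ∣⁅x⁆∣≡1; ⊆-antisym)
open import Data.Empty using (⊥-elim)
open import Function using (_∘_)
open import Relation.Nullary using (yes; no)
open import Relation.Binary.PropositionalEquality
  using (_≡_; _≢_; refl; sym; trans; cong; cong₂; subst)

TwoLinked : ∀ {n} → Graph n → Set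
TwoLinked {n} G = ∀ u v → u ≢ v → ∃ λ (w : Fin n) → Adj G u w × Adj G v w

singleton-openPacking : ∀ {n} (G : Graph n) x → IsOpenPacking G ⁅ x ⁆
singleton-openPacking G x u v u∈ v∈ u≢v _ _ =
  u≢v (trans (x∈⁅y⁆⇒x≡y x u∈) (sym (x∈⁅y⁆⇒x≡y x v∈)))

module _ {n : ℕ} (G : Graph n) (linked : TwoLinked G) where

  openPacking-subsingleton : ∀ {P} → IsOpenPacking G P →
                             ∀ {u v} → u ∈ P → v ∈ P → u ≡ v
  openPacking-subsingleton packing {u} {v} u∈P v∈P with u ≟ v
  ... | yes u≡v = u≡v
  ... | no  u≢v = let (w , uw , vw) = linked u v u≢v
                  in ⊥-elim (packing u v u∈P v∈P u≢v w (uw , vw))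

  -- In a graph with at least one vertex a maximal open packing is nonempty:
  -- otherwise it would be strictly contained in a singleton.
  maximalOpenPacking-nonempty : Fin n → ∀ {P} → IsMaximalOpenPacking G P →
                                Nonempty P
  maximalOpenPacking-nonempty v {P} (_ , maximal) with nonempty? P
  ... | yes nonempty = nonempty
  ... | no  empty    = v , subst (v ∈_) ⁅v⁆≡P (x∈⁅x⁆ v)
    where
    ⁅v⁆≡P : ⁅ v ⁆ ≡ P
    ⁅v⁆≡P = maximal ⁅ v ⁆ (singleton-openPacking G v) (λ {y} y∈P → ⊥-elim (empty (y , y∈P)))

  maximalOpenPacking-size : Fin n → ∀ {P} → IsMaximalOpenPacking G P → ∣ P ∣ ≡ 1
  maximalOpenPacking-size v {P} maximalP@(packing , _)
    with x , x∈P ← maximalOpenPacking-nonempty v maximalP =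
    trans (cong ∣_∣ P≡⁅x⁆) (∣⁅x⁆∣≡1 x)
    where
    P⊆⁅x⁆ : P ⊆ ⁅ x ⁆
    P⊆⁅x⁆ y∈P = subst (_∈ ⁅ x ⁆) (openPacking-subsingleton packing x∈P y∈P) (x∈⁅x⁆ x)

    ⁅x⁆⊆P : ⁅ x ⁆ ⊆ P
    ⁅x⁆⊆P y∈⁅x⁆ = subst (_∈ P) (sym (x∈⁅y⁆⇒x≡y x y∈⁅x⁆)) x∈P

    P≡⁅x⁆ : P ≡ ⁅ x ⁆
    P≡⁅x⁆ = ⊆-antisym P⊆⁅x⁆ ⁅x⁆⊆P

  twoLinked-equalSize : Fin n → AllMaximalOpenPackingsEqualSize G
  twoLinked-equalSize v P Q maximalP maximalQ =
    trans (maximalOpenPacking-size v maximalP) (sym (maximalOpenPacking-size v maximalQ))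

module Join {a b : ℕ} (H : Graph a) (K : Graph b) where

  joinAdj : Fin a ⊎ Fin b → Fin a ⊎ Fin b → Bool
  joinAdj (inj₁ u) (inj₁ v) = adj H u v
  joinAdj (inj₂ u) (inj₂ v) = adj K u v
  joinAdj (inj₁ _) (inj₂ _) = true
  joinAdj (inj₂ _) (inj₁ _) = true

  joinAdj-sym : ∀ x y → joinAdj x y ≡ joinAdj y x
  joinAdj-sym (inj₁ u) (inj₁ v) = Graph.sym H u v
  joinAdj-sym (inj₂ u) (inj₂ v) = Graph.sym K u v
  joinAdj-sym (inj₁ _) (inj₂ _) = refl
  joinAdj-sym (inj₂ _) (inj₁ _) = refl

  joinAdj-irrefl : ∀ x → joinAdj x x ≡ false
  joinAdj-irrefl (inj₁ u) = Graph.irrefl H u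
  joinAdj-irrefl (inj₂ u) = Graph.irrefl K u

  joinGraph : Graph (a + b)
  joinGraph = record
    { adj    = λ u v → joinAdj (splitAt a u) (splitAt a v)
    ; sym    = λ u v → joinAdj-sym (splitAt a u) (splitAt a v)
    ; irrefl = λ u → joinAdj-irrefl (splitAt a u)
    }

  left-induced : IsInducedSubgraph H joinGraph
  left-induced =
    (_↑ˡ b) , ↑ˡ-injective b _ _ ,
    λ u v → sym (cong₂ joinAdj (splitAt-↑ˡ a u b) (splitAt-↑ˡ a v b))

  joinAdj-twoLinked : Fin b → TwoLinked K → (∀ t → ∃ λ t′ → Adj K t t′) →
    ∀ x y → x ≢ y → ∃ λ w → joinAdj x w ≡ true × joinAdj y w ≡ true
  joinAdj-twoLinked t₀ _ _ (inj₁ _) (inj₁ _) _ = inj₂ t₀ , refl , refl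
  joinAdj-twoLinked _ _ neighbour (inj₁ _) (inj₂ t) _ =
    let (t′ , tt′) = neighbour t in inj₂ t′ , refl , tt′
  joinAdj-twoLinked _ _ neighbour (inj₂ t) (inj₁ _) _ =
    let (t′ , tt′) = neighbour t in inj₂ t′ , tt′ , refl
  joinAdj-twoLinked _ linked _ (inj₂ t) (inj₂ s) x≢y =
    let (w , tw , sw) = linked t s (x≢y ∘ cong inj₂) in inj₂ w , tw , sw

  join-twoLinked : Fin b → TwoLinked K → (∀ t → ∃ λ t′ → Adj K t t′) →
                   TwoLinked joinGraph
  join-twoLinked t₀ linked neighbour u v u≢v =
    let (w , uw , vw) = joinAdj-twoLinked t₀ linked neighbour
                          (splitAt a u) (splitAt a v) (u≢v ∘ splitAt-injective)
    in join a b w , adjacent-to-join u uw , adjacent-to-join v vw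
    where
    splitAt-injective : ∀ {u v} → splitAt a u ≡ splitAt a v → u ≡ v
    splitAt-injective {u} {v} eq =
      trans (sym (join-splitAt a b u)) (trans (cong (join a b) eq) (join-splitAt a b v))

    adjacent-to-join : ∀ u {w} → joinAdj (splitAt a u) w ≡ true → Adj joinGraph u (join a b w)
    adjacent-to-join u {w} uw =
      subst (λ x → joinAdj (splitAt a u) x ≡ true) (sym (splitAt-join a b w)) uw

_∨_ : ∀ {a b} → Graph a → Graph b → Graph (a + b)
H ∨ K = Join.joinGraph H K

triangleAdj : Fin 3 → Fin 3 → Bool
triangleAdj u v with u ≟ v
... | yes _ = false
... | no  _ = true

triangle : Graph 3
triangle = record { adj = triangleAdj ; sym = symmetric ; irrefl = irreflexive }
  where
  symmetric : ∀ u v → triangleAdj u v ≡ triangleAdj v u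
  symmetric u v with u ≟ v | v ≟ u
  ... | yes _   | yes _   = refl
  ... | no  _   | no  _   = refl
  ... | yes u≡v | no  v≢u = ⊥-elim (v≢u (sym u≡v))
  ... | no  u≢v | yes v≡u = ⊥-elim (u≢v (sym v≡u))

  irreflexive : ∀ u → triangleAdj u u ≡ false
  irreflexive u with u ≟ u
  ... | yes _   = refl
  ... | no  u≢u = ⊥-elim (u≢u refl)

-- The third vertex of the triangle is adjacent to the other two.
triangle-twoLinked : TwoLinked triangle
triangle-twoLinked zero          zero          0≢0 = ⊥-elim (0≢0 refl)
triangle-twoLinked zero          (suc zero)    _   = suc (suc zero) , refl , refl
triangle-twoLinked zero          (suc (suc zero)) _ = suc zero , refl , refl
triangle-twoLinked (suc zero)    zero          _   = suc (suc zero) , refl , refl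
triangle-twoLinked (suc zero)    (suc zero)    1≢1 = ⊥-elim (1≢1 refl)
triangle-twoLinked (suc zero)    (suc (suc zero)) _ = zero , refl , refl
triangle-twoLinked (suc (suc zero)) zero       _   = suc zero , refl , refl
triangle-twoLinked (suc (suc zero)) (suc zero) _   = zero , refl , refl
triangle-twoLinked (suc (suc zero)) (suc (suc zero)) 2≢2 = ⊥-elim (2≢2 refl)

triangle-neighbour : ∀ t → ∃ λ t′ → Adj triangle t t′
triangle-neighbour zero             = suc zero , refl
triangle-neighbour (suc zero)       = zero , refl
triangle-neighbour (suc (suc zero)) = zero , refl

proposition3 : ∀ (m : ℕ) (H : Graph m) →
    Σ ℕ λ n → Σ (Graph n) λ G →
      AllMaximalOpenPackingsEqualSize G × IsInducedSubgraph H G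
proposition3 m H =
  m + 3 , H ∨ triangle ,
  twoLinked-equalSize (H ∨ triangle)
    (join-twoLinked zero triangle-twoLinked triangle-neighbour) (m ↑ʳ zero) ,
  left-induced
  where open Join H triangle
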